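{- Let $n,m$ be coprime, $d\ge1$, $N=dn$, $M=dm$, and let $G\in T^d_{n,m}$ with vertex set $\{0,\dots,d-1\}$ numbered so that the function $f$ (length of the longest oriented path from the source) is weakly increasing, so that $0$ is the source; let $s_i$ be the label of vertex $i$. Put $S_i=d s_i+i$ for $i=0,\dots,d-1$. Then $\bigsqcup_i S_i$ is the skeleton of some $\Delta\in\mathcal M_{N,M}$, and $M_0=ds_0,\ M_1=ds_1+f(1),\dots,M_{d-1}=ds_{d-1}+f(d-1)$ is the minimal integral acceptable shift of $S_0,\dots,S_{d-1}$, i.e. $M_i=S_i+m_i$ with $m_i$ the minimal integral acceptable shifting.
   Context: A subset $\Gamma\subseteq\mathbb Z$ is $(n,m)$-invariant if $\Gamma+n,\Gamma+m\subseteq\Gamma$; its skeleton is its set of $n$-generators (elements of $\Gamma\setminus(\Gamma+n)$) and $m$-cogenerators (elements of $(\Gamma-m)\setminus\Gamma$). $T^d_{n,m}$ is the set (up to label-preserving isomorphism) of acyclically oriented graphs on $d$ vertices with a unique source, vertices labeled by skeletons of $(n,m)$-invariant subsets of $\mathbb Z_{\ge0}$, the source's label being the skeleton of a subset with minimum $0$, and with two labels intersecting iff the vertices are joined by an edge. For $\Delta\subseteq\mathbb Z_{\ge0}$, $\Delta\in\mathcal M_{N,M}$ means $\min\Delta=0$ and $\Delta+N,\Delta+M\subseteq\Delta$; its skeleton is the set of $N$-generators and $M$-cogenerators, with parts $S_i$ in residue class $i$ mod $d$. Given sets $S_0,\dots,S_{d-1}$ (each in one residue class mod $d$), let $b_{ij}=\min\{y-x:x\in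 S_i,y\in S_j,y>x\}-1$ ($+\infty$ if empty) for $i\ne j$; the minimal integral acceptable shifting is $m_0=0$, $m_i=\max\sum_{\ell=1}^{k-1}(-b_{i_{\ell+1}i_\ell})$ over sequences $i=i_1,\dots,i_k=0$ in $\{0,\dots,d-1\}$, and the minimal integral acceptable shift is $S_i+m_i$. -}

module Defs where

open import Level using (0ℓ)
open import Data.Nat as ℕ using (ℕ; zero; suc)
open import Data.Nat.Coprimality using (Coprime)
open import Data.Integer as ℤ using (ℤ; +_; _+_; _-_; _*_; -_; _≤_; _<_)
open import Data.Fin using (Fin; toℕ)
open import Data.Product using (Σ; ∃; ∃-syntax; _×_; _,_)
open import Data.Sum using (_⊎_)
open import Relation.Nullary using (¬_)
open import Relation.Binary.PropositionalEquality using (_≡_; _≢_)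
open import Relation.Unary using (Pred; _∈_; _≐_; _≬_)

ℤSet : Set₁
ℤSet = Pred ℤ 0ℓ

Gen : ℕ → ℤSet → ℤSet
Gen a Γ x = Γ x × ¬ Γ (x - + a)

Cogen : ℕ → ℤSet → ℤSet
Cogen b Γ x = Γ (x + + b) × ¬ Γ x

Skeleton : ℕ → ℕ → ℤSet → ℤSet
Skeleton a b Γ x = Gen a Γ x ⊎ Cogen b Γ x

InvariantNonneg : ℕ → ℕ → ℤSet → Set
InvariantNonneg a b Γ =
  (∀ x → Γ x → + 0 ≤ x) × (∀ x → Γ x → Γ (x + + a)) × (∀ x → Γ x → Γ (x + + b))

InM : ℕ → ℕ → ℤSet → Set
InM A B Δ = InvariantNonneg A B Δ × Δ (+ 0)

IsSkeletonLabel : ℕ → ℕ → ℤSet → Set₁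
IsSkeletonLabel a b s = ∃[ Γ ] (InvariantNonneg a b Γ × (s ≐ Skeleton a b Γ))

IsSourceLabel : ℕ → ℕ → ℤSet → Set₁
IsSourceLabel a b s = ∃[ Γ ] (InvariantNonneg a b Γ × Γ (+ 0) × (s ≐ Skeleton a b Γ))

Affine : ℤ → ℤ → ℤSet → ℤSet
Affine c t s x = ∃[ y ] (s y × x ≡ c * y + t)

Shift : ℤSet → ℤ → ℤSet
Shift s t x = ∃[ y ] (s y × x ≡ y + t)

data Path {d : ℕ} (E : Fin d → Fin d → Set) : Fin d → Fin d → ℕ → Set where
  here : ∀ {i} → Path E i i 0
  step : ∀ {i j k ℓ} → E i j → Path E j k ℓ → Path E i k (suc ℓ)

Acyclic : {d : ℕ} → (Fin d → Fin d → Set) → Set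
Acyclic E = ∀ i ℓ → ¬ Path E i i (suc ℓ)

UniqueSourceZero : {k : ℕ} → (Fin (suc k) → Fin (suc k) → Set) → Set
UniqueSourceZero E = (∀ j → ¬ E j Data.Fin.zero) × (∀ i → i ≢ Data.Fin.zero → ∃[ j ] E j i)

IsLongestPathLength : {d : ℕ} → (Fin d → Fin d → Set) → Fin d → Fin d → ℕ → Set
IsLongestPathLength E u v ℓ = Path E u v ℓ × (∀ ℓ′ → Path E u v ℓ′ → ℓ′ ℕ.≤ ℓ)

IsTGraph : (n m k : ℕ) → (Fin (suc k) → Fin (suc k) → Set) → (Fin (suc k) → ℤSet) → Set₁
IsTGraph n m k E s =
  Acyclic E ×
  UniqueSourceZero E ×
  (∀ i → IsSkeletonLabel n m (s i)) ×
  IsSourceLabel n m (s Data.Fin.zero) ×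
  (∀ i j → i ≢ j → ((E i j ⊎ E j i) → s i ≬ s j) × (s i ≬ s j → (E i j ⊎ E j i)))

-- IsB S i j b : the set {y - x : x ∈ S i, y ∈ S j, y > x} is nonempty and
-- b = (its minimum) - 1   (the case b_{ij} = +∞ is when no such b exists)
IsB : {d : ℕ} → (Fin d → ℤSet) → Fin d → Fin d → ℤ → Set
IsB S i j b =
  (∃[ x ] ∃[ y ] (S i x × S j y × x < y × y - x ≡ b + + 1)) ×
  (∀ x y → S i x → S j y → x < y → b + + 1 ≤ y - x)

-- ChainVal S i v : there is a sequence i = i₁, …, i_k = 0 (consecutive
-- entries distinct) with all b_{i_{ℓ+1} i_ℓ} finite and
-- v = Σ_{ℓ=1}^{k-1} (- b_{i_{ℓ+1} i_ℓ}).
-- (Sequences involving some b = +∞ have value -∞ and never attain the max.)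
data ChainVal {k : ℕ} (S : Fin (suc k) → ℤSet) : Fin (suc k) → ℤ → Set where
  end  : ChainVal S Data.Fin.zero (+ 0)
  cons : ∀ {i j b v} → i ≢ j → IsB S j i b → ChainVal S j v → ChainVal S i (- b + v)

IsMax : (ℤ → Set) → ℤ → Set
IsMax P v = P v × (∀ w → P w → w ≤ v)

IsMinShifting : {k : ℕ} → (Fin (suc k) → ℤSet) → (Fin (suc k) → ℤ) → Set
IsMinShifting S m = (m Data.Fin.zero ≡ + 0) × (∀ i → i ≢ Data.Fin.zero → IsMax (ChainVal S i) (m i))

IsMinShift : {k : ℕ} → (Fin (suc k) → ℤSet) → (Fin (suc k) → ℤSet) → Set
IsMinShift S M = ∃[ m ] (IsMinShifting S m × (∀ i → M i ≐ Shift (S i) (m i)))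

-- Writing D = d = k + 1, every integer is uniquely D y + i with 0 ≤ i < D, so the sets
-- D Γᵢ + i are disjoint and the union Δ of the D Γᵢ + i inherits the invariance of the Γᵢ
-- under D n and D m, with skeleton the union of the D sᵢ + i. For the shifting, put
-- mᵢ = f(i) − i. An edge j → i of G forces f(j) < f(i) and, by monotonicity of f, j < i;
-- this makes x + mⱼ < y + mᵢ whenever x ∈ Sⱼ, y ∈ Sᵢ, x < y (compare D-digits; equal digits
-- mean sⱼ ∩ sᵢ ≠ ∅, i.e. an edge), so every chain has value at most mᵢ. Conversely a
-- longest path 0 → ⋯ → p → i read backwards is a chain with b_{pi} = i − p − 1 on each
-- edge, of value exactly f(i) − i.
module Submission where

open import Defs
open import Data.Nat as ℕ using (ℕ; suc; _≤_; NonZero)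
open import Data.Nat.Coprimality using (Coprime)
open import Data.Integer using (+_)
open import Data.Fin using (Fin; toℕ; zero)
open import Data.Product using (∃-syntax; _×_)
open import Relation.Unary using (_≐_)

import Data.Nat.Properties as ℕP
open import Data.Integer as ℤ using (ℤ; _+_; _-_; _*_; -_; 0ℤ; 1ℤ; +≤+; +<+)
import Data.Integer.Properties as ℤP
open import Data.Integer.Tactic.RingSolver using (solve-∀)
import Data.Fin.Properties as FP
open import Data.Product using (_,_; proj₁; proj₂)
open import Data.Sum using (_⊎_; inj₁; inj₂)
open import Data.Empty using (⊥-elim)
open import Relation.Nullary using (yes; no)
open import Relation.Unary using (_≬_)
open import Relation.Unary.Properties using (≐-trans)
open import Relation.Binary using (tri<; tri≈; tri>)
open import Relation.Binary.PropositionalEquality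

interleave-< : ∀ k {x y} i j → x ℤ.< y → i ≤ k → + suc k * x + + i ℤ.< + suc k * y + + j
interleave-< k {x} {y} i j x<y i≤k = begin-strict
  D * x + + i        ≤⟨ ℤP.+-monoʳ-≤ (D * x) (+≤+ i≤k) ⟩
  D * x + + k        <⟨ ℤP.+-monoʳ-< (D * x) (+<+ (ℕP.n<1+n k)) ⟩
  D * x + D          ≡⟨ distrib D x ⟩
  D * (1ℤ + x)       ≤⟨ ℤP.*-monoˡ-≤-nonNeg D (ℤP.i<j⇒suc[i]≤j x<y) ⟩
  D * y              ≤⟨ ℤP.i≤i+j (D * y) (+ j) ⟩
  D * y + + j        ∎
  where
  open ℤP.≤-Reasoning
  D : ℤ
  D = + suc k
  distrib : ∀ a b → a * b + a ≡ a * (1ℤ + b)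
  distrib = solve-∀

interleave-<⇒≤ : ∀ k {x y} i j → j ≤ k → + suc k * x + + i ℤ.< + suc k * y + + j → x ℤ.≤ y
interleave-<⇒≤ k i j j≤k lt = ℤP.≮⇒≥ λ y<x → ℤP.<-asym lt (interleave-< k j i y<x j≤k)

interleave-injective : ∀ k {x y} (i j : Fin (suc k)) →
  + suc k * x + + toℕ i ≡ + suc k * y + + toℕ j → x ≡ y × i ≡ j
interleave-injective k {x} {y} i j eq with ℤP.<-cmp x y
... | tri< x<y _ _ = ⊥-elim (ℤP.<-irrefl eq (interleave-< k (toℕ i) (toℕ j) x<y (FP.toℕ≤pred[n] i)))
... | tri> _ _ y<x = ⊥-elim (ℤP.<-irrefl (sym eq) (interleave-< k (toℕ j) (toℕ i) y<x (FP.toℕ≤pred[n] j)))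
... | tri≈ _ refl _ = refl , FP.toℕ-injective (ℤP.+-injective (cancel (+ suc k * x) eq))
  where
  cancel : ∀ a {b c} → a + b ≡ a + c → b ≡ c
  cancel a {b} {c} a+b≡a+c = begin
    b            ≡⟨ minus a b ⟩
    (a + b) - a  ≡⟨ cong (_- a) a+b≡a+c ⟩
    (a + c) - a  ≡⟨ minus a c ⟨
    c            ∎
    where
    open ≡-Reasoning
    minus : ∀ a b → b ≡ (a + b) - a
    minus = solve-∀

interleave-+ : ∀ k y i c → (+ suc k * y + i) + + (suc k ℕ.* c) ≡ + suc k * (y + + c) + i
interleave-+ k y i c = trans (cong (λ z → (+ suc k * y + i) + z) (ℤP.pos-* (suc k) c)) (identity (+ suc k) y i (+ c))
  where
  identity : ∀ D y i c → (D * y + i) + D * c ≡ D * (y + c) + i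
  identity = solve-∀

interleave-minus : ∀ k y i c → (+ suc k * y + i) - + (suc k ℕ.* c) ≡ + suc k * (y - + c) + i
interleave-minus k y i c = trans (cong (λ z → (+ suc k * y + i) - z) (ℤP.pos-* (suc k) c)) (identity (+ suc k) y i (+ c))
  where
  identity : ∀ D y i c → (D * y + i) - D * c ≡ D * (y - c) + i
  identity = solve-∀

y-x≡b+1∧x+a<y+c⇒-b+a≤c : ∀ {b x y a c} → y - x ≡ b + 1ℤ → x + a ℤ.< y + c → - b + a ℤ.≤ c
y-x≡b+1∧x+a<y+c⇒-b+a≤c {b} {x} {y} {a} {c} y-x≡b+1 x+a<y+c = begin
  - b + a            ≡⟨ cong (λ t → - t + a) (b≡y-x-1 b (y - x) y-x≡b+1) ⟩
  - (y - x - 1ℤ) + a ≡⟨ regroup x y a ⟩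
  (1ℤ + (x + a)) - y ≤⟨ ℤP.+-monoˡ-≤ (- y) (ℤP.i<j⇒suc[i]≤j x+a<y+c) ⟩
  (y + c) - y        ≡⟨ cancel y c ⟩
  c                  ∎
  where
  open ℤP.≤-Reasoning
  b≡y-x-1 : ∀ b t → t ≡ b + 1ℤ → b ≡ t - 1ℤ
  b≡y-x-1 b _ refl = b≡b+1-1 b
    where
    b≡b+1-1 : ∀ b → b ≡ b + 1ℤ - 1ℤ
    b≡b+1-1 = solve-∀
  regroup : ∀ x y a → - (y - x - 1ℤ) + a ≡ (1ℤ + (x + a)) - y
  regroup = solve-∀
  cancel : ∀ y c → (y + c) - y ≡ c
  cancel = solve-∀

Interleaving : (k : ℕ) → (Fin (suc k) → ℤSet) → ℤSet
Interleaving k Γ x = ∃[ i ] Affine (+ suc k) (+ toℕ i) (Γ i) x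

module _ {k : ℕ} where

  interleaving⁻ : ∀ {Γ : Fin (suc k) → ℤSet} {i y} →
    Interleaving k Γ (+ suc k * y + + toℕ i) → Γ i y
  interleaving⁻ {i = i} {y} (j , y′ , γ , eq) with interleave-injective k {y} {y′} i j eq
  ... | refl , refl = γ

  interleaving-cong : ∀ {Γ Γ′ : Fin (suc k) → ℤSet} → (∀ i → Γ i ≐ Γ′ i) →
    Interleaving k Γ ≐ Interleaving k Γ′
  interleaving-cong Γ≐Γ′ =
    (λ { (i , y , γ , eq) → i , y , proj₁ (Γ≐Γ′ i) γ , eq }) ,
    (λ { (i , y , γ , eq) → i , y , proj₂ (Γ≐Γ′ i) γ , eq })

  interleaving-skeleton : ∀ n m (Γ : Fin (suc k) → ℤSet) →
    Interleaving k (λ i → Skeleton n m (Γ i)) ≐ Skeleton (suc k ℕ.* n) (suc k ℕ.* m) (Interleaving k Γ)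
  interleaving-skeleton n m Γ = sub , sup
    where
    sub : ∀ {x} → Interleaving k (λ i → Skeleton n m (Γ i)) x →
          Skeleton (suc k ℕ.* n) (suc k ℕ.* m) (Interleaving k Γ) x
    sub (i , y , inj₁ (γ , ¬γ) , refl) =
      inj₁ ((i , y , γ , refl) , λ δ → ¬γ (interleaving⁻ (subst (Interleaving k Γ) (interleave-minus k y _ n) δ)))
    sub (i , y , inj₂ (γ , ¬γ) , refl) =
      inj₂ ((i , y + + m , γ , interleave-+ k y _ m) , λ δ → ¬γ (interleaving⁻ δ))

    sup : ∀ {x} → Skeleton (suc k ℕ.* n) (suc k ℕ.* m) (Interleaving k Γ) x →
          Interleaving k (λ i → Skeleton n m (Γ i)) x
    sup (inj₁ ((i , y , γ , refl) , ¬δ)) =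
      i , y , inj₁ (γ , λ γ′ → ¬δ (i , y - + n , γ′ , interleave-minus k y _ n)) , refl
    sup {x} (inj₂ ((i , y , γ , eq) , ¬δ)) =
      i , y - + m , inj₂ (subst (Γ i) (y≡y-c+c y (+ m)) γ , λ γ′ → ¬δ (i , y - + m , γ′ , x≡)) , x≡
      where
      y≡y-c+c : ∀ y c → y ≡ (y - c) + c
      y≡y-c+c = solve-∀
      x≡x+c-c : ∀ x c → x ≡ (x + c) - c
      x≡x+c-c = solve-∀
      x≡ : x ≡ + suc k * (y - + m) + + toℕ i
      x≡ = trans (x≡x+c-c x _) (trans (cong (_- + (suc k ℕ.* m)) eq) (interleave-minus k y _ m))

  interleaving-InM : ∀ {n m} (Γ : Fin (suc k) → ℤSet) → (∀ i → InvariantNonneg n m (Γ i)) →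
    Γ zero (+ 0) → InM (suc k ℕ.* n) (suc k ℕ.* m) (Interleaving k Γ)
  interleaving-InM {n} {m} Γ inv 0∈Γ₀ = (nonneg , +n , +m) , zero , + 0 , 0∈Γ₀ , 0≡
    where
    D : ℤ
    D = + suc k
    0≡ : + 0 ≡ D * + 0 + + 0
    0≡ = sym (trans (ℤP.+-identityʳ _) (ℤP.*-zeroʳ D))
    nonneg : ∀ x → Interleaving k Γ x → + 0 ℤ.≤ x
    nonneg _ (i , y , γ , refl) = ℤP.+-mono-≤ {0ℤ} {D * y} {0ℤ} {+ toℕ i}
      (subst (ℤ._≤ D * y) (ℤP.*-zeroʳ D) (ℤP.*-monoˡ-≤-nonNeg D (proj₁ (inv i) y γ))) (+≤+ ℕ.z≤n)
    +n : ∀ x → Interleaving k Γ x → Interleaving k Γ (x + + (suc k ℕ.* n))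
    +n _ (i , y , γ , refl) = i , y + + n , proj₁ (proj₂ (inv i)) y γ , interleave-+ k y _ n
    +m : ∀ x → Interleaving k Γ x → Interleaving k Γ (x + + (suc k ℕ.* m))
    +m _ (i , y , γ , refl) = i , y + + m , proj₂ (proj₂ (inv i)) y γ , interleave-+ k y _ m

snoc : ∀ {d} {E : Fin d → Fin d → Set} {u v w ℓ} → Path E u v ℓ → E v w → Path E u w (suc ℓ)
snoc here e = step e here
snoc (step e′ p) e = step e′ (snoc p e)

unsnoc : ∀ {d} {E : Fin d → Fin d → Set} {u w ℓ} → Path E u w (suc ℓ) → ∃[ v ] (Path E u v ℓ × E v w)
unsnoc (step e here) = _ , here , e
unsnoc (step e p@(step _ _)) with unsnoc p
... | v , q , e′ = v , step e q , e′

module LongestPaths {k : ℕ} {E : Fin (suc k) → Fin (suc k) → Set} (acyclic : Acyclic E)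
  {f : Fin (suc k) → ℕ} (longest : ∀ i → IsLongestPathLength E zero i (f i))
  (monotone : ∀ i j → toℕ i ≤ toℕ j → f i ≤ f j) where

  f-source : f zero ≡ 0
  f-source with f zero | proj₁ (longest zero)
  ... | 0     | _ = refl
  ... | suc ℓ | p = ⊥-elim (acyclic zero ℓ p)

  edge⇒f< : ∀ {a b} → E a b → f a ℕ.< f b
  edge⇒f< {a} {b} e = proj₂ (longest b) (suc (f a)) (snoc (proj₁ (longest a)) e)

  edge⇒toℕ< : ∀ {a b} → E a b → toℕ a ℕ.< toℕ b
  edge⇒toℕ< {a} {b} e = ℕP.≰⇒> λ b≤a → ℕP.<⇒≱ (edge⇒f< e) (monotone b a b≤a)

  path⇒toℕ+≤toℕ : ∀ {u v ℓ} → Path E u v ℓ → toℕ u ℕ.+ ℓ ≤ toℕ v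
  path⇒toℕ+≤toℕ {u} here = ℕP.≤-reflexive (ℕP.+-identityʳ (toℕ u))
  path⇒toℕ+≤toℕ {u} {v} {suc ℓ} (step {j = j} e p) = begin
    toℕ u ℕ.+ suc ℓ   ≡⟨ ℕP.+-suc (toℕ u) ℓ ⟩
    suc (toℕ u) ℕ.+ ℓ ≤⟨ ℕP.+-monoˡ-≤ ℓ (edge⇒toℕ< e) ⟩
    toℕ j ℕ.+ ℓ       ≤⟨ path⇒toℕ+≤toℕ p ⟩
    toℕ v             ∎
    where open ℕP.≤-Reasoning

  f≤k : ∀ i → f i ≤ k
  f≤k i = ℕP.≤-trans (path⇒toℕ+≤toℕ (proj₁ (longest i))) (FP.toℕ≤pred[n] i)

module MinimalShift {k : ℕ} {E : Fin (suc k) → Fin (suc k) → Set} (s : Fin (suc k) → ℤSet)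
  (adjacency : ∀ i j → i ≢ j → ((E i j ⊎ E j i) → s i ≬ s j) × (s i ≬ s j → E i j ⊎ E j i))
  (acyclic : Acyclic E) {f : Fin (suc k) → ℕ} (longest : ∀ i → IsLongestPathLength E zero i (f i))
  (monotone : ∀ i j → toℕ i ≤ toℕ j → f i ≤ f j) where

  open LongestPaths acyclic longest monotone

  D : ℤ
  D = + suc k

  S : Fin (suc k) → ℤSet
  S i = Affine D (+ toℕ i) (s i)

  shifting : Fin (suc k) → ℤ
  shifting i = + f i - + toℕ i

  shift-interleave : ∀ y i → (D * y + + toℕ i) + shifting i ≡ D * y + + f i
  shift-interleave y i = identity D y (+ f i) (+ toℕ i)
    where
    identity : ∀ D y a b → (D * y + b) + (a - b) ≡ D * y + a
    identity = solve-∀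

  shift-≐ : ∀ i → Affine D (+ f i) (s i) ≐ Shift (S i) (shifting i)
  shift-≐ i =
    (λ { (y , sy , refl) → D * y + + toℕ i , (y , sy , refl) , sym (shift-interleave y i) }) ,
    (λ { (_ , (y , sy , refl) , refl) → y , sy , shift-interleave y i })

  shifting-preserves-< : ∀ {i j x y} → i ≢ j → S j x → S i y → x ℤ.< y →
    x + shifting j ℤ.< y + shifting i
  shifting-preserves-< {i} {j} i≢j (x′ , sx , refl) (y′ , sy , refl) lt
    rewrite shift-interleave x′ j | shift-interleave y′ i with x′ ℤ.≟ y′
  ... | no x′≢y′ = interleave-< k (f j) (f i) x′<y′ (f≤k j)
    where
    x′<y′ : x′ ℤ.< y′
    x′<y′ = ℤP.≤∧≢⇒< (interleave-<⇒≤ k (toℕ j) (toℕ i) (FP.toℕ≤pred[n] i) lt) x′≢y′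
  ... | yes refl with proj₂ (adjacency i j i≢j) (x′ , sy , sx)
  ...   | inj₁ i→j = ⊥-elim (ℤP.<⇒≱ lt (ℤP.+-monoʳ-≤ (D * x′) (+≤+ (ℕP.<⇒≤ (edge⇒toℕ< i→j)))))
  ...   | inj₂ j→i = ℤP.+-monoʳ-< (D * x′) (+<+ (edge⇒f< j→i))

  chainVal-≤ : ∀ {i v} → ChainVal S i v → v ℤ.≤ shifting i
  chainVal-≤ end = ℤP.≤-reflexive (cong (λ z → + z - + 0) (sym f-source))
  chainVal-≤ (cons {i} {j} {b} {v} i≢j ((x , y , x∈ , y∈ , x<y , y-x≡b+1) , _) chain) = begin
    - b + v          ≤⟨ ℤP.+-monoʳ-≤ (- b) (chainVal-≤ chain) ⟩
    - b + shifting j ≤⟨ y-x≡b+1∧x+a<y+c⇒-b+a≤c {b} {x} {y} y-x≡b+1 (shifting-preserves-< i≢j x∈ y∈ x<y) ⟩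
    shifting i       ∎
    where open ℤP.≤-Reasoning

  edgeGap : Fin (suc k) → Fin (suc k) → ℤ
  edgeGap p i = + toℕ i - + toℕ p - 1ℤ

  edgeGap+1 : ∀ x p i → edgeGap p i + 1ℤ ≡ (D * x + + toℕ i) - (D * x + + toℕ p)
  edgeGap+1 x p i = identity D x (+ toℕ i) (+ toℕ p)
    where
    identity : ∀ D x a b → (a - b - 1ℤ) + 1ℤ ≡ (D * x + a) - (D * x + b)
    identity = solve-∀

  isB-edge : ∀ {p i} → E p i → IsB S p i (edgeGap p i)
  isB-edge {p} {i} e with proj₁ (adjacency p i p≢i) (inj₁ e)
    where
    p≢i : p ≢ i
    p≢i refl = ℕP.<-irrefl refl (edge⇒toℕ< e)
  ... | c , sp , si =
    (D * c + + toℕ p , D * c + + toℕ i , (c , sp , refl) , (c , si , refl) ,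
      ℤP.+-monoʳ-< (D * c) (+<+ (edge⇒toℕ< e)) , sym (edgeGap+1 c p i)) , minimal
    where
    minimal : ∀ x y → S p x → S i y → x ℤ.< y → edgeGap p i + 1ℤ ℤ.≤ y - x
    minimal _ _ (x′ , _ , refl) (y′ , _ , refl) lt = begin
      edgeGap p i + 1ℤ                          ≡⟨ edgeGap+1 x′ p i ⟩
      (D * x′ + + toℕ i) - (D * x′ + + toℕ p)   ≤⟨ ℤP.+-monoˡ-≤ (- (D * x′ + + toℕ p)) (ℤP.+-monoˡ-≤ (+ toℕ i) D*x′≤D*y′) ⟩
      (D * y′ + + toℕ i) - (D * x′ + + toℕ p)   ∎
      where
      open ℤP.≤-Reasoning
      D*x′≤D*y′ : D * x′ ℤ.≤ D * y′
      D*x′≤D*y′ = ℤP.*-monoˡ-≤-nonNeg D (interleave-<⇒≤ k {x′} {y′} (toℕ p) (toℕ i) (FP.toℕ≤pred[n] i) lt)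

  longestPath⇒chainVal : ∀ {i} ℓ → Path E zero i ℓ → f i ≡ ℓ → ChainVal S i (shifting i)
  longestPath⇒chainVal 0 here f0≡0 = subst (ChainVal S zero) (cong (λ z → + z - + 0) (sym f0≡0)) end
  longestPath⇒chainVal {i} (suc ℓ) path fi≡1+ℓ with unsnoc path
  ... | p , path′ , e = subst (ChainVal S i) value (cons {b = edgeGap p i} i≢p (isB-edge e) (longestPath⇒chainVal ℓ path′ fp≡ℓ))
    where
    i≢p : i ≢ p
    i≢p refl = ℕP.<-irrefl refl (edge⇒toℕ< e)
    fp≡ℓ : f p ≡ ℓ
    fp≡ℓ = ℕP.≤-antisym (ℕ.s≤s⁻¹ (subst (suc (f p) ≤_) fi≡1+ℓ (edge⇒f< e))) (proj₂ (longest p) ℓ path′)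
    identity : ∀ i p ℓ → - (i - p - 1ℤ) + (ℓ - p) ≡ (1ℤ + ℓ) - i
    identity = solve-∀
    value : - edgeGap p i + shifting p ≡ shifting i
    value rewrite fi≡1+ℓ | fp≡ℓ = identity (+ toℕ i) (+ toℕ p) (+ ℓ)

  minimalShift : IsMinShift S (λ i → Affine D (+ f i) (s i))
  minimalShift = shifting ,
    (cong (λ z → + z - + 0) f-source ,
     λ i _ → longestPath⇒chainVal (f i) (proj₁ (longest i)) refl , λ _ → chainVal-≤) ,
    shift-≐

skeletonSets : ∀ {n m k E} {s : Fin (suc k) → ℤSet} → IsTGraph n m k E s →
  ∃[ Γ ] ((∀ i → InvariantNonneg n m (Γ i)) × Γ zero (+ 0) × (∀ i → s i ≐ Skeleton n m (Γ i)))
skeletonSets {n} {m} {k} {E} {s} (_ , _ , labels , (Γ₀ , inv₀ , 0∈Γ₀ , skel₀) , _) = Γ , inv , 0∈Γ₀ , skel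
  where
  Γ : Fin (suc k) → ℤSet
  Γ zero = Γ₀
  Γ i@(Data.Fin.suc _) = proj₁ (labels i)
  inv : ∀ i → InvariantNonneg n m (Γ i)
  inv zero = inv₀
  inv i@(Data.Fin.suc _) = proj₁ (proj₂ (labels i))
  skel : ∀ i → s i ≐ Skeleton n m (Γ i)
  skel zero = skel₀
  skel i@(Data.Fin.suc _) = proj₂ (proj₂ (labels i))

mainTheorem11 : (n m : ℕ) → .{{NonZero n}} → .{{NonZero m}} → Coprime n m →
    (k : ℕ) →
    (E : Fin (suc k) → Fin (suc k) → Set) → (s : Fin (suc k) → ℤSet) →
    IsTGraph n m k E s →
    (f : Fin (suc k) → ℕ) →
    (∀ i → IsLongestPathLength E zero i (f i)) →
    (∀ i j → toℕ i ≤ toℕ j → f i ≤ f j) →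
    (∃[ Δ ] (InM (suc k ℕ.* n) (suc k ℕ.* m) Δ ×
      ((λ x → ∃[ i ] Affine (+ suc k) (+ toℕ i) (s i) x) ≐ Skeleton (suc k ℕ.* n) (suc k ℕ.* m) Δ)))
    × IsMinShift (λ i → Affine (+ suc k) (+ toℕ i) (s i)) (λ i → Affine (+ suc k) (+ f i) (s i))
mainTheorem11 n m _ k E s G@(acyclic , _ , _ , _ , adjacency) f longest monotone
  with skeletonSets G
... | Γ , invariant , 0∈Γ₀ , skeleton =
  (Interleaving k Γ , interleaving-InM Γ invariant 0∈Γ₀ ,
    ≐-trans (interleaving-cong skeleton) (interleaving-skeleton n m Γ)) ,
  MinimalShift.minimalShift s adjacency acyclic longest monotone
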